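{- In the simply-typed $\lambda$-calculus with holes, if $\Gamma,X{:}\xi\vdash r:\phi$ and $\Gamma\vdash t:\xi$, then $\Gamma\vdash r[X:=t]:\phi$.
   Context: Fix a countably infinite set $\mathbb A$ of atoms partitioned into disjoint countably infinite sets $\mathbb A=\mathbb A_{\mathrm d}\uplus\mathbb A_{\mathrm u}$, and a countably infinite set of unknowns $X,Y,\dots$. Types $\phi::=\tau\mid\phi\to\phi$; constants $C$ with types $\mathrm{type}(C)$. Terms: $r::=a\mid C\mid X[b_i{:=}s_i]_{i=1}^n\mid \lambda c{:}\phi.s\mid rs$, with $\{b_1,\dots,b_n\}\subseteq\mathbb A_{\mathrm d}$ distinct and $c\in\mathbb A_{\mathrm u}$, up to $\alpha$-equivalence (renaming bound atoms within $\mathbb A_{\mathrm u}$); an unknown $Y$ alone denotes $Y$ with empty moderation. Free atoms: $\mathrm{fa}(a)=\{a\}$, $\mathrm{fa}(C)=\varnothing$, $\mathrm{fa}(rs)=\mathrm{fa}(r)\cup\mathrm{fa}(s)$, $\mathrm{fa}(\lambda a{:}\phi.r)=\mathrm{fa}(r)\setminus\{a\}$, $\mathrm{fa}(X[b_i{:=}s_i])=(\mathbb A_{\mathrm d}\setminus\{b_i\})\cup\bigcup_i\mathrm{fa}(s_i)$. Level 1 substitution $r[b_i{:=}s_i]_{i\in B}$: $b_j[b_i{:=}s_i]=s_j$; $a[b_i{:=}s_i]=a$ for $a\notin\{b_i\}$; $C[\dots]=C$; distributes over application; $(\lambda c{:}\phi.r)[b_i{:=}s_i]=\lambda c{:}\phi.(r[b_i{:=}s_i])$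 for $c\in\mathbb A_{\mathrm u}$ not among the $b_i$ nor free in the $s_i$; $X[b_i{:=}s_i]_{i\in A}[b_i{:=}s_i]_{i\in B}=X[(b_i{:=}s_i)_{i\in B\setminus A,\ b_i\in\mathbb A_{\mathrm d}},\ (b_i{:=}s_i[b_j{:=}s_j]_{j\in B})_{i\in A}]$. Level 2 substitution $[X:=t]$ (mapping $X$ to $t$ and every other unknown $Y$ to $Y$), written $r[X:=t]$: $a[X:=t]=a$; $C[X:=t]=C$; $(rs)[X:=t]=(r[X:=t])(s[X:=t])$; $(\lambda a{:}\phi.s)[X:=t]=\lambda a{:}\phi.(s[X:=t])$ with $a\in\mathbb A_{\mathrm u}$ chosen not free in $t$; $(X[b_i{:=}s_i]_1^n)[X:=t]=t[b_i{:=}s_i[X:=t]]_1^n$ and $(Y[b_i{:=}s_i]_1^n)[X:=t]=Y[b_i{:=}s_i[X:=t]]_1^n$. Type environments $\Gamma$: functional sets of typings $a{:}\phi$ and $X{:}\phi$. Typing rules: $\Gamma\vdash a:\phi$ if $a{:}\phi\in\Gamma$; $\Gamma\vdash C:\mathrm{type}(C)$; from $\Gamma,a{:}\phi\vdash r:\psi$ with $a\in\mathbb A_{\mathrm u}$ infer $\Gamma\vdash\lambda a{:}\phi.r:\phi\to\psi$; from $\Gamma\vdash r:\phi\to\psi$, $\Gamma\vdash s:\phi$ infer $\Gamma\vdash rs:\psi$; (Meta) if $X{:}\phi\in\Gamma$, $b_i{:}\psi_i\in\Gamma$ and $\Gamma\vdash s_i:\psi_i$ ($1\le i\le n$) then $\Gamma\vdash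 X[b_i{:=}s_i]_1^n:\phi$. -}

module Defs where

open import Data.Nat using (ℕ; zero; suc; _<ᵇ_; _≡ᵇ_)
open import Data.Bool using (Bool; true; false; if_then_else_; _∨_)
open import Data.List using (List; []; _∷_; _++_; map)
open import Data.Maybe using (Maybe; just; nothing)
open import Data.Product using (_×_; _,_; proj₁; ∃-syntax)
open import Relation.Binary.PropositionalEquality using (_≡_)
open import Data.List.Membership.Propositional using (_∈_; _∉_)
open import Data.List.Relation.Unary.Unique.Propositional using (Unique)

infixr 30 _⇒_
data Ty (B : Set) : Set where
  base : B → Ty B
  _⇒_  : Ty B → Ty B → Ty B

-- Atoms: 𝔸 = 𝔸_d ⊎ 𝔸_u, each a copy of ℕ (countably infinite).

data Atom : Set where
  d : ℕ → Atom
  u : ℕ → Atom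

Unknown : Set
Unknown = ℕ

-- Terms up to α-equivalence, in locally-nameless style: λ-bound atoms
-- (which are always in 𝔸_u) are represented by de Bruijn indices
-- (bvar), free atoms by names.
-- A moderation [b₁:=s₁,…,bₙ:=sₙ] is a list of pairs (bᵢ , sᵢ) where
-- bᵢ is (the index of) an atom of 𝔸_d.

data Term (B C : Set) : Set where
  atom : Atom → Term B C
  bvar : ℕ → Term B C
  con  : C → Term B C
  meta : Unknown → List (ℕ × Term B C) → Term B C
  lam  : Ty B → Term B C → Term B C
  _·_  : Term B C → Term B C → Term B C

Moderation : Set → Set → Set
Moderation B C = List (ℕ × Term B C)

module _ {B C : Set} where

  keys : Moderation B C → List ℕ
  keys = map proj₁

  mutual
    data WF : Term B C → Set where
      atom : ∀ a → WF (atom a)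
      bvar : ∀ i → WF (bvar i)
      con  : ∀ c → WF (con c)
      meta : ∀ X ms → Unique (keys ms) → WFMod ms → WF (meta X ms)
      lam  : ∀ φ r → WF r → WF (lam φ r)
      app  : ∀ r s → WF r → WF s → WF (r · s)

    data WFMod : Moderation B C → Set where
      []  : WFMod []
      _∷_ : ∀ {b s ms} → WF s → WFMod ms → WFMod ((b , s) ∷ ms)

  -- Free atoms of 𝔸_u (fa(r) ∩ 𝔸_u, a finite set; the 𝔸_d-part of fa is
  -- never needed since λ binds only atoms of 𝔸_u).

  mutual
    faᵤ : Term B C → List ℕ
    faᵤ (atom (d n)) = []
    faᵤ (atom (u n)) = n ∷ []
    faᵤ (bvar i)     = []
    faᵤ (con c)      = []
    faᵤ (meta X ms)  = faᵤMod ms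
    faᵤ (lam φ r)    = faᵤ r
    faᵤ (r · s)      = faᵤ r ++ faᵤ s

    faᵤMod : Moderation B C → List ℕ
    faᵤMod []             = []
    faᵤMod ((b , s) ∷ ms) = faᵤ s ++ faᵤMod ms

  mutual
    shift : ℕ → Term B C → Term B C
    shift k (atom a)    = atom a
    shift k (bvar i)    = if i <ᵇ k then bvar i else bvar (suc i)
    shift k (con c)     = con c
    shift k (meta X ms) = meta X (shiftMod k ms)
    shift k (lam φ r)   = lam φ (shift (suc k) r)
    shift k (r · s)     = shift k r · shift k s

    shiftMod : ℕ → Moderation B C → Moderation B C
    shiftMod k []             = []
    shiftMod k ((b , s) ∷ ms) = (b , shift k s) ∷ shiftMod k ms

  mutual
    instantiateAt : ℕ → Atom → Term B C → Term B C
    instantiateAt k a (atom c)    = atom c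
    instantiateAt k a (bvar i)    = if i ≡ᵇ k then atom a else bvar i
    instantiateAt k a (con c)     = con c
    instantiateAt k a (meta X ms) = meta X (instantiateMod k a ms)
    instantiateAt k a (lam φ r)   = lam φ (instantiateAt (suc k) a r)
    instantiateAt k a (r · s)     = instantiateAt k a r · instantiateAt k a s

    instantiateMod : ℕ → Atom → Moderation B C → Moderation B C
    instantiateMod k a []             = []
    instantiateMod k a ((b , s) ∷ ms) = (b , instantiateAt k a s) ∷ instantiateMod k a ms

  instantiate : Term B C → Atom → Term B C
  instantiate r a = instantiateAt 0 a r

  lookupMod : ℕ → Moderation B C → Maybe (Term B C)
  lookupMod n []             = nothing
  lookupMod n ((b , s) ∷ σ)  = if n ≡ᵇ b then just s else lookupMod n σ

  memᵇ : ℕ → List ℕ → Bool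
  memᵇ n []       = false
  memᵇ n (m ∷ ms) = (n ≡ᵇ m) ∨ memᵇ n ms

  dropKeys : List ℕ → Moderation B C → Moderation B C
  dropKeys ks []            = []
  dropKeys ks ((b , s) ∷ σ) = if memᵇ b ks then dropKeys ks σ else (b , s) ∷ dropKeys ks σ

  mutual
    _[_]₁ : Term B C → Moderation B C → Term B C
    atom (d n) [ σ ]₁ with lookupMod n σ
    ... | just s  = s
    ... | nothing = atom (d n)
    atom (u n) [ σ ]₁ = atom (u n)
    bvar i     [ σ ]₁ = bvar i
    con c      [ σ ]₁ = con c
    meta X ρ   [ σ ]₁ = meta X (substMod ρ σ ++ dropKeys (keys ρ) σ)
    -- capture avoidance is automatic (locally nameless); dangling
    -- indices of σ are shifted when going under the binder
    lam φ r    [ σ ]₁ = lam φ (r [ shiftMod 0 σ ]₁)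
    (r · s)    [ σ ]₁ = (r [ σ ]₁) · (s [ σ ]₁)

    substMod : Moderation B C → Moderation B C → Moderation B C
    substMod []             σ = []
    substMod ((b , s) ∷ ρ)  σ = (b , s [ σ ]₁) ∷ substMod ρ σ

  mutual
    _[_≔_]₂ : Term B C → Unknown → Term B C → Term B C
    atom a    [ X ≔ t ]₂ = atom a
    bvar i    [ X ≔ t ]₂ = bvar i
    con c     [ X ≔ t ]₂ = con c
    meta Y ms [ X ≔ t ]₂ =
      if Y ≡ᵇ X then t [ subst₂Mod ms X t ]₁ else meta Y (subst₂Mod ms X t)
    lam φ s   [ X ≔ t ]₂ = lam φ (s [ X ≔ t ]₂)
    (r · s)   [ X ≔ t ]₂ = (r [ X ≔ t ]₂) · (s [ X ≔ t ]₂)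

    subst₂Mod : Moderation B C → Unknown → Term B C → Moderation B C
    subst₂Mod []             X t = []
    subst₂Mod ((b , s) ∷ ms) X t = (b , s [ X ≔ t ]₂) ∷ subst₂Mod ms X t

record Ctx (B : Set) : Set where
  constructor ctx
  field
    atoms : List (Atom × Ty B)
    unks  : List (Unknown × Ty B)
open Ctx public

Functional : {K B : Set} → List (K × Ty B) → Set
Functional xs = ∀ {k φ ψ} → (k , φ) ∈ xs → (k , ψ) ∈ xs → φ ≡ ψ

IsEnv : {B : Set} → Ctx B → Set
IsEnv Γ = Functional (atoms Γ) × Functional (unks Γ)

_,ᵃ_∶_ : {B : Set} → Ctx B → Atom → Ty B → Ctx B
Γ ,ᵃ a ∶ φ = ctx ((a , φ) ∷ atoms Γ) (unks Γ)

_,ˣ_∶_ : {B : Set} → Ctx B → Unknown → Ty B → Ctx B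
Γ ,ˣ X ∶ φ = ctx (atoms Γ) ((X , φ) ∷ unks Γ)

module _ {B C : Set} (ctype : C → Ty B) where

  mutual
    data _⊢_∶_ (Γ : Ctx B) : Term B C → Ty B → Set where
      ⊢atom : ∀ {a φ} → (a , φ) ∈ atoms Γ → Γ ⊢ atom a ∶ φ
      ⊢con  : ∀ {c} → Γ ⊢ con c ∶ ctype c
      -- from Γ,a:φ ⊢ r : ψ with a ∈ 𝔸_u infer Γ ⊢ λa:φ.r : φ → ψ
      -- (a is the name given to the bound atom, so it is fresh for the body)
      ⊢lam  : ∀ {φ ψ r} (n : ℕ) → n ∉ faᵤ r → IsEnv (Γ ,ᵃ u n ∶ φ) →
              (Γ ,ᵃ u n ∶ φ) ⊢ instantiate r (u n) ∶ ψ →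
              Γ ⊢ lam φ r ∶ (φ ⇒ ψ)
      ⊢app  : ∀ {r s φ ψ} → Γ ⊢ r ∶ (φ ⇒ ψ) → Γ ⊢ s ∶ φ → Γ ⊢ r · s ∶ ψ
      ⊢meta : ∀ {X φ ms} → (X , φ) ∈ unks Γ → ModTyped Γ ms → Γ ⊢ meta X ms ∶ φ

    data ModTyped (Γ : Ctx B) : Moderation B C → Set where
      []  : ModTyped Γ []
      _∷_ : ∀ {b s ms} → (∃[ ψ ] ((d b , ψ) ∈ atoms Γ × Γ ⊢ s ∶ ψ)) →
            ModTyped Γ ms → ModTyped Γ ((b , s) ∷ ms)

-- The typing rule for λ names the bound atom by ONE particular fresh name n.
-- After substitution n may no longer be fresh (it may occur in t), so the
-- body derivation cannot be reused verbatim.  We therefore prove every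
-- preservation lemma for a renamed term  rn ρ r , where ρ renames the atoms
-- of 𝔸_u; in the λ case we pick a name m fresh for the result and the
-- environment, and continue the induction with ρ updated to send n to m.
-- This keeps every induction structural on the typing derivation.
module Submission where

open import Defs
open import Data.Nat using (ℕ; suc; _<ᵇ_; _≡ᵇ_; _<_; _≤_; z≤n; s≤s)
open import Data.Nat.Properties
open import Data.Nat.ListAction using (sum)
open import Data.Bool using (true; false; T; if_then_else_)
open import Data.Bool.Properties using (T-≡)
open import Data.List using (List; []; _∷_; _++_)
open import Data.List.Relation.Unary.Any using (here; there)
open import Data.List.Membership.Propositional using (_∈_; _∉_)
open import Data.List.Membership.Propositional.Properties using (∈-++⁺ˡ; ∈-++⁺ʳ)
open import Data.Maybe using (Maybe; just; nothing)
import Data.Maybe as Maybe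
open import Data.Product using (_×_; _,_; proj₁)
open import Data.Unit using (⊤; tt)
open import Data.Empty using (⊥-elim)
open import Function.Bundles using (Equivalence)
open import Relation.Binary.PropositionalEquality

≡ᵇ-true⇒≡ : ∀ {m n} → (m ≡ᵇ n) ≡ true → m ≡ n
≡ᵇ-true⇒≡ {m} {n} eq = ≡ᵇ⇒≡ m n (Equivalence.from T-≡ eq)

≡ᵇ-false⇒≢ : ∀ {m n} → (m ≡ᵇ n) ≡ false → m ≢ n
≡ᵇ-false⇒≢ {m} {n} eq m≡n = subst T eq (≡⇒≡ᵇ m n m≡n)

≡⇒≡ᵇ-true : ∀ {m n} → m ≡ n → (m ≡ᵇ n) ≡ true
≡⇒≡ᵇ-true {m} {n} m≡n = Equivalence.to T-≡ (≡⇒≡ᵇ m n m≡n)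

≢⇒≡ᵇ-false : ∀ {m n} → m ≢ n → (m ≡ᵇ n) ≡ false
≢⇒≡ᵇ-false {m} {n} m≢n with m ≡ᵇ n in eq
... | true  = ⊥-elim (m≢n (≡ᵇ-true⇒≡ eq))
... | false = refl

<⇒<ᵇ-true : ∀ {m n} → m < n → (m <ᵇ n) ≡ true
<⇒<ᵇ-true m<n = Equivalence.to T-≡ (<⇒<ᵇ m<n)

<ᵇ-true⇒< : ∀ {m n} → (m <ᵇ n) ≡ true → m < n
<ᵇ-true⇒< {m} {n} eq = <ᵇ⇒< m n (Equivalence.from T-≡ eq)

fresh : List ℕ → ℕ
fresh xs = suc (sum xs)

∈⇒≤sum : ∀ {x xs} → x ∈ xs → x ≤ sum xs
∈⇒≤sum {xs = y ∷ ys} (here refl) = m≤m+n y (sum ys)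
∈⇒≤sum {xs = y ∷ ys} (there p)   = ≤-trans (∈⇒≤sum p) (m≤n+m (sum ys) y)

fresh∉ : ∀ xs → fresh xs ∉ xs
fresh∉ xs p = 1+n≰n (∈⇒≤sum p)

_[_↦_] : (ℕ → ℕ) → ℕ → ℕ → ℕ → ℕ
(ρ [ n ↦ m ]) x = if x ≡ᵇ n then m else ρ x

update-at : ∀ ρ n m → (ρ [ n ↦ m ]) n ≡ m
update-at ρ n m rewrite ≡⇒≡ᵇ-true {n} refl = refl

renameAtom : (ℕ → ℕ) → Atom → Atom
renameAtom ρ (d n) = d n
renameAtom ρ (u n) = u (ρ n)

module _ {B C : Set} where

  mutual
    rn : (ℕ → ℕ) → Term B C → Term B C
    rn ρ (atom a)    = atom (renameAtom ρ a)
    rn ρ (bvar i)    = bvar i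
    rn ρ (con c)     = con c
    rn ρ (meta X ms) = meta X (rnMod ρ ms)
    rn ρ (lam φ r)   = lam φ (rn ρ r)
    rn ρ (r · s)     = rn ρ r · rn ρ s

    rnMod : (ℕ → ℕ) → Moderation B C → Moderation B C
    rnMod ρ []             = []
    rnMod ρ ((b , s) ∷ ms) = (b , rn ρ s) ∷ rnMod ρ ms

  mutual
    rn-id : (r : Term B C) → rn (λ x → x) r ≡ r
    rn-id (atom (d n)) = refl
    rn-id (atom (u n)) = refl
    rn-id (bvar i)     = refl
    rn-id (con c)      = refl
    rn-id (meta X ms)  = cong (meta X) (rnMod-id ms)
    rn-id (lam φ r)    = cong (lam φ) (rn-id r)
    rn-id (r · s)      = cong₂ _·_ (rn-id r) (rn-id s)

    rnMod-id : (ms : Moderation B C) → rnMod (λ x → x) ms ≡ ms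
    rnMod-id []             = refl
    rnMod-id ((b , s) ∷ ms) = cong₂ (λ s' ms' → (b , s') ∷ ms') (rn-id s) (rnMod-id ms)

  mutual
    rn-open : ∀ ρ k n (r : Term B C) →
              rn ρ (instantiateAt k (u n) r) ≡ instantiateAt k (u (ρ n)) (rn ρ r)
    rn-open ρ k n (atom a) = refl
    rn-open ρ k n (bvar i) with i ≡ᵇ k
    ... | true  = refl
    ... | false = refl
    rn-open ρ k n (con c)     = refl
    rn-open ρ k n (meta X ms) = cong (meta X) (rnMod-open ρ k n ms)
    rn-open ρ k n (lam φ r)   = cong (lam φ) (rn-open ρ (suc k) n r)
    rn-open ρ k n (r · s)     = cong₂ _·_ (rn-open ρ k n r) (rn-open ρ k n s)

    rnMod-open : ∀ ρ k n (ms : Moderation B C) →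
                 rnMod ρ (instantiateMod k (u n) ms) ≡ instantiateMod k (u (ρ n)) (rnMod ρ ms)
    rnMod-open ρ k n []             = refl
    rnMod-open ρ k n ((b , s) ∷ ms) =
      cong₂ (λ s' ms' → (b , s') ∷ ms') (rn-open ρ k n s) (rnMod-open ρ k n ms)

  mutual
    rn-update-fresh : ∀ ρ n m (r : Term B C) → n ∉ faᵤ r → rn (ρ [ n ↦ m ]) r ≡ rn ρ r
    rn-update-fresh ρ n m (atom (d x)) _ = refl
    rn-update-fresh ρ n m (atom (u x)) n∉
      rewrite ≢⇒≡ᵇ-false {x} {n} (λ x≡n → n∉ (here (sym x≡n))) = refl
    rn-update-fresh ρ n m (bvar i) _      = refl
    rn-update-fresh ρ n m (con c) _       = refl
    rn-update-fresh ρ n m (meta X ms) n∉  = cong (meta X) (rnMod-update-fresh ρ n m ms n∉)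
    rn-update-fresh ρ n m (lam φ r) n∉    = cong (lam φ) (rn-update-fresh ρ n m r n∉)
    rn-update-fresh ρ n m (r · s) n∉      =
      cong₂ _·_ (rn-update-fresh ρ n m r (λ p → n∉ (∈-++⁺ˡ p)))
                (rn-update-fresh ρ n m s (λ p → n∉ (∈-++⁺ʳ (faᵤ r) p)))

    rnMod-update-fresh : ∀ ρ n m (ms : Moderation B C) → n ∉ faᵤMod ms →
                         rnMod (ρ [ n ↦ m ]) ms ≡ rnMod ρ ms
    rnMod-update-fresh ρ n m [] _               = refl
    rnMod-update-fresh ρ n m ((b , s) ∷ ms) n∉  =
      cong₂ (λ s' ms' → (b , s') ∷ ms')
            (rn-update-fresh ρ n m s (λ p → n∉ (∈-++⁺ˡ p)))
            (rnMod-update-fresh ρ n m ms (λ p → n∉ (∈-++⁺ʳ (faᵤ s) p)))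

  rename-open : ∀ ρ {n} m (r : Term B C) → n ∉ faᵤ r →
                rn (ρ [ n ↦ m ]) (instantiate r (u n)) ≡ instantiate (rn ρ r) (u m)
  rename-open ρ {n} m r n∉ = begin
    rn (ρ [ n ↦ m ]) (instantiate r (u n))
      ≡⟨ rn-open (ρ [ n ↦ m ]) 0 n r ⟩
    instantiateAt 0 (u ((ρ [ n ↦ m ]) n)) (rn (ρ [ n ↦ m ]) r)
      ≡⟨ cong₂ (λ x r' → instantiateAt 0 (u x) r') (update-at ρ n m) (rn-update-fresh ρ n m r n∉) ⟩
    instantiate (rn ρ r) (u m) ∎
    where open ≡-Reasoning

  mutual
    lc : ℕ → Term B C → Set
    lc k (atom a)    = ⊤
    lc k (bvar i)    = i < k
    lc k (con c)     = ⊤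
    lc k (meta X ms) = lcMod k ms
    lc k (lam φ r)   = lc (suc k) r
    lc k (r · s)     = lc k r × lc k s

    lcMod : ℕ → Moderation B C → Set
    lcMod k []             = ⊤
    lcMod k ((b , s) ∷ ms) = lc k s × lcMod k ms

  mutual
    lc-opened : ∀ k a (r : Term B C) → lc k (instantiateAt k a r) → lc (suc k) r
    lc-opened k a (atom x) _ = tt
    lc-opened k a (bvar i) h with i ≡ᵇ k in eq
    ... | true  = subst (λ j → i < suc j) (≡ᵇ-true⇒≡ eq) ≤-refl
    ... | false = m<n⇒m<1+n h
    lc-opened k a (con c) _              = tt
    lc-opened k a (meta X ms) h          = lcMod-opened k a ms h
    lc-opened k a (lam φ r) h            = lc-opened (suc k) a r h
    lc-opened k a (r · s) (hr , hs)      = lc-opened k a r hr , lc-opened k a s hs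

    lcMod-opened : ∀ k a (ms : Moderation B C) → lcMod k (instantiateMod k a ms) → lcMod (suc k) ms
    lcMod-opened k a [] _                     = tt
    lcMod-opened k a ((b , s) ∷ ms) (hs , hms) = lc-opened k a s hs , lcMod-opened k a ms hms

  mutual
    open-lc : ∀ j k a (r : Term B C) → lc j r → j ≤ k → instantiateAt k a r ≡ r
    open-lc j k a (atom x) _ _ = refl
    open-lc j k a (bvar i) i<j j≤k
      rewrite ≢⇒≡ᵇ-false {i} {k} (<⇒≢ (<-≤-trans i<j j≤k)) = refl
    open-lc j k a (con c) _ _                 = refl
    open-lc j k a (meta X ms) h j≤k           = cong (meta X) (openMod-lc j k a ms h j≤k)
    open-lc j k a (lam φ r) h j≤k             = cong (lam φ) (open-lc (suc j) (suc k) a r h (s≤s j≤k))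
    open-lc j k a (r · s) (hr , hs) j≤k       = cong₂ _·_ (open-lc j k a r hr j≤k) (open-lc j k a s hs j≤k)

    openMod-lc : ∀ j k a (ms : Moderation B C) → lcMod j ms → j ≤ k → instantiateMod k a ms ≡ ms
    openMod-lc j k a [] _ _                   = refl
    openMod-lc j k a ((b , s) ∷ ms) (hs , hms) j≤k =
      cong₂ (λ s' ms' → (b , s') ∷ ms') (open-lc j k a s hs j≤k) (openMod-lc j k a ms hms j≤k)

  mutual
    shift-lc : ∀ k (r : Term B C) → lc k r → shift k r ≡ r
    shift-lc k (atom x) _                 = refl
    shift-lc k (bvar i) i<k rewrite <⇒<ᵇ-true i<k = refl
    shift-lc k (con c) _                  = refl
    shift-lc k (meta X ms) h              = cong (meta X) (shiftMod-lc k ms h)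
    shift-lc k (lam φ r) h                = cong (lam φ) (shift-lc (suc k) r h)
    shift-lc k (r · s) (hr , hs)          = cong₂ _·_ (shift-lc k r hr) (shift-lc k s hs)

    shiftMod-lc : ∀ k (ms : Moderation B C) → lcMod k ms → shiftMod k ms ≡ ms
    shiftMod-lc k [] _                    = refl
    shiftMod-lc k ((b , s) ∷ ms) (hs , hms) =
      cong₂ (λ s' ms' → (b , s') ∷ ms') (shift-lc k s hs) (shiftMod-lc k ms hms)

  mutual
    open-shift : ∀ j k a (s : Term B C) → j ≤ k →
                 instantiateAt (suc k) a (shift j s) ≡ shift j (instantiateAt k a s)
    open-shift j k a (atom x) _ = refl
    open-shift j k a (bvar i) j≤k with i <ᵇ j in lt | i ≡ᵇ k in eq
    ... | true  | true  =
      ⊥-elim (<⇒≢ (<-≤-trans (subst (_< j) (≡ᵇ-true⇒≡ eq) (<ᵇ-true⇒< lt)) j≤k) refl)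
    ... | true  | false
      rewrite lt | ≢⇒≡ᵇ-false {i} {suc k} (<⇒≢ (<-≤-trans (<ᵇ-true⇒< lt) (≤-trans j≤k (n≤1+n k)))) = refl
    ... | false | true  rewrite eq = refl
    ... | false | false rewrite lt | eq = refl
    open-shift j k a (con c) _           = refl
    open-shift j k a (meta X ms) j≤k     = cong (meta X) (openMod-shift j k a ms j≤k)
    open-shift j k a (lam φ r) j≤k       = cong (lam φ) (open-shift (suc j) (suc k) a r (s≤s j≤k))
    open-shift j k a (r · s) j≤k         = cong₂ _·_ (open-shift j k a r j≤k) (open-shift j k a s j≤k)

    openMod-shift : ∀ j k a (ms : Moderation B C) → j ≤ k →
                    instantiateMod (suc k) a (shiftMod j ms) ≡ shiftMod j (instantiateMod k a ms)
    openMod-shift j k a [] _               = refl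
    openMod-shift j k a ((b , s) ∷ ms) j≤k =
      cong₂ (λ s' ms' → (b , s') ∷ ms') (open-shift j k a s j≤k) (openMod-shift j k a ms j≤k)

  atomSub : ℕ → Maybe (Term B C) → Term B C
  atomSub n (just s) = s
  atomSub n nothing  = atom (d n)

  atom-subst : ∀ n (σ : Moderation B C) → atom (d n) [ σ ]₁ ≡ atomSub n (lookupMod n σ)
  atom-subst n σ with lookupMod n σ
  ... | just s  = refl
  ... | nothing = refl

  lookup-open : ∀ n k a (σ : Moderation B C) →
                lookupMod n (instantiateMod k a σ) ≡ Maybe.map (instantiateAt k a) (lookupMod n σ)
  lookup-open n k a [] = refl
  lookup-open n k a ((b , s) ∷ σ) with n ≡ᵇ b
  ... | true  = refl
  ... | false = lookup-open n k a σ

  keys-open : ∀ k a (σ : Moderation B C) → keys (instantiateMod k a σ) ≡ keys σ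
  keys-open k a []            = refl
  keys-open k a ((b , s) ∷ σ) = cong (b ∷_) (keys-open k a σ)

  dropKeys-open : ∀ k a ks (σ : Moderation B C) →
                  instantiateMod k a (dropKeys ks σ) ≡ dropKeys ks (instantiateMod k a σ)
  dropKeys-open k a ks [] = refl
  dropKeys-open k a ks ((b , s) ∷ σ) with memᵇ {B} {C} b ks
  ... | true  = dropKeys-open k a ks σ
  ... | false = cong ((b , instantiateAt k a s) ∷_) (dropKeys-open k a ks σ)

  ++-open : ∀ k a (σ τ : Moderation B C) →
            instantiateMod k a (σ ++ τ) ≡ instantiateMod k a σ ++ instantiateMod k a τ
  ++-open k a []            τ = refl
  ++-open k a ((b , s) ∷ σ) τ = cong ((b , instantiateAt k a s) ∷_) (++-open k a σ τ)

  mutual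
    open-subst₁ : ∀ k c (r : Term B C) (σ : Moderation B C) →
                  instantiateAt k (u c) (r [ σ ]₁) ≡ (instantiateAt k (u c) r) [ instantiateMod k (u c) σ ]₁
    open-subst₁ k c (atom (d n)) σ
      rewrite atom-subst n σ | atom-subst n (instantiateMod k (u c) σ) | lookup-open n k (u c) σ
      with lookupMod n σ
    ... | just s  = refl
    ... | nothing = refl
    open-subst₁ k c (atom (u n)) σ = refl
    open-subst₁ k c (bvar i) σ with i ≡ᵇ k
    ... | true  = refl
    ... | false = refl
    open-subst₁ k c (con x) σ = refl
    open-subst₁ k c (meta X ρ) σ = cong (meta X) (begin
      instantiateMod k (u c) (substMod ρ σ ++ dropKeys (keys ρ) σ)
        ≡⟨ ++-open k (u c) (substMod ρ σ) (dropKeys (keys ρ) σ) ⟩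
      instantiateMod k (u c) (substMod ρ σ) ++ instantiateMod k (u c) (dropKeys (keys ρ) σ)
        ≡⟨ cong₂ _++_ (openMod-subst₁ k c ρ σ) (dropKeys-open k (u c) (keys ρ) σ) ⟩
      substMod ρ' σ' ++ dropKeys (keys ρ) σ'
        ≡⟨ cong (λ ks → substMod ρ' σ' ++ dropKeys ks σ') (sym (keys-open k (u c) ρ)) ⟩
      substMod ρ' σ' ++ dropKeys (keys ρ') σ' ∎)
      where
        open ≡-Reasoning
        ρ' = instantiateMod k (u c) ρ
        σ' = instantiateMod k (u c) σ
    open-subst₁ k c (lam φ r) σ = cong (lam φ)
      (trans (open-subst₁ (suc k) c r (shiftMod 0 σ))
             (cong (instantiateAt (suc k) (u c) r [_]₁) (openMod-shift 0 k (u c) σ z≤n)))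
    open-subst₁ k c (r · s) σ = cong₂ _·_ (open-subst₁ k c r σ) (open-subst₁ k c s σ)

    openMod-subst₁ : ∀ k c (ρ σ : Moderation B C) →
                     instantiateMod k (u c) (substMod ρ σ) ≡
                     substMod (instantiateMod k (u c) ρ) (instantiateMod k (u c) σ)
    openMod-subst₁ k c [] σ            = refl
    openMod-subst₁ k c ((b , s) ∷ ρ) σ =
      cong₂ (λ s' ρ' → (b , s') ∷ ρ') (open-subst₁ k c s σ) (openMod-subst₁ k c ρ σ)

  open-subst₁-closed : ∀ m (r : Term B C) (σ : Moderation B C) → lcMod 0 σ →
                       instantiate (r [ σ ]₁) (u m) ≡ (instantiate r (u m)) [ σ ]₁
  open-subst₁-closed m r σ lcσ =
    trans (open-subst₁ 0 m r σ) (cong (instantiate r (u m) [_]₁) (openMod-lc 0 0 (u m) σ lcσ z≤n))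

  module _ (X : Unknown) (t : Term B C) (lct : lc 0 t) where
    mutual
      open-subst₂ : ∀ k c (r : Term B C) →
                    instantiateAt k (u c) (r [ X ≔ t ]₂) ≡ (instantiateAt k (u c) r) [ X ≔ t ]₂
      open-subst₂ k c (atom a) = refl
      open-subst₂ k c (bvar i) with i ≡ᵇ k
      ... | true  = refl
      ... | false = refl
      open-subst₂ k c (con x) = refl
      open-subst₂ k c (meta Y ms) with Y ≡ᵇ X
      ... | true  = trans (open-subst₁ k c t (subst₂Mod ms X t))
                          (cong₂ _[_]₁ (open-lc 0 k (u c) t lct z≤n) (openMod-subst₂ k c ms))
      ... | false = cong (meta Y) (openMod-subst₂ k c ms)
      open-subst₂ k c (lam φ r) = cong (lam φ) (open-subst₂ (suc k) c r)
      open-subst₂ k c (r · s)   = cong₂ _·_ (open-subst₂ k c r) (open-subst₂ k c s)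

      openMod-subst₂ : ∀ k c (ms : Moderation B C) →
                       instantiateMod k (u c) (subst₂Mod ms X t) ≡ subst₂Mod (instantiateMod k (u c) ms) X t
      openMod-subst₂ k c []             = refl
      openMod-subst₂ k c ((b , s) ∷ ms) =
        cong₂ (λ s' ms' → (b , s') ∷ ms') (open-subst₂ k c s) (openMod-subst₂ k c ms)

unames : ∀ {B : Set} → List (Atom × Ty B) → List ℕ
unames []                = []
unames ((d n , _) ∷ xs)  = unames xs
unames ((u n , _) ∷ xs)  = n ∷ unames xs

unames-∈ : ∀ {B : Set} {n ψ} {xs : List (Atom × Ty B)} → (u n , ψ) ∈ xs → n ∈ unames xs
unames-∈ {xs = (u m , _) ∷ xs} (here refl) = here refl
unames-∈ {xs = (d m , _) ∷ xs} (there p)   = unames-∈ p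
unames-∈ {xs = (u m , _) ∷ xs} (there p)   = there (unames-∈ p)

extend-env : ∀ {B : Set} {Γ : Ctx B} {m φ} → IsEnv Γ → m ∉ unames (atoms Γ) → IsEnv (Γ ,ᵃ u m ∶ φ)
extend-env {Γ = Γ} {m} {φ} (funA , funU) m∉ = funA' , funU
  where
    funA' : Functional ((u m , φ) ∷ atoms Γ)
    funA' (here refl) (here refl) = refl
    funA' (here refl) (there q)   = ⊥-elim (m∉ (unames-∈ q))
    funA' (there p)   (here refl) = ⊥-elim (m∉ (unames-∈ p))
    funA' (there p)   (there q)   = funA p q

record AtomMap {B : Set} (ρ : ℕ → ℕ) (Γ Γ' : Ctx B) : Set where
  field
    map-d : ∀ {b ψ} → (d b , ψ) ∈ atoms Γ → (d b , ψ) ∈ atoms Γ'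
    map-u : ∀ {a ψ} → (u a , ψ) ∈ atoms Γ → (u (ρ a) , ψ) ∈ atoms Γ'
open AtomMap

atomMap-id : ∀ {B : Set} {Γ : Ctx B} → AtomMap (λ x → x) Γ Γ
map-d atomMap-id p = p
map-u atomMap-id p = p

atomMap-weaken : ∀ {B : Set} {Γ : Ctx B} {m φ} → AtomMap (λ x → x) Γ (Γ ,ᵃ u m ∶ φ)
map-d atomMap-weaken p = there p
map-u atomMap-weaken p = there p

atomMap-extend : ∀ {B : Set} {ρ} {Γ Γ' : Ctx B} {n m φ} → AtomMap ρ Γ Γ' →
                 Functional ((u n , φ) ∷ atoms Γ) →
                 AtomMap (ρ [ n ↦ m ]) (Γ ,ᵃ u n ∶ φ) (Γ' ,ᵃ u m ∶ φ)
map-d (atomMap-extend am fun) (here ())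
map-d (atomMap-extend am fun) (there p) = there (map-d am p)
map-u (atomMap-extend {ρ = ρ} {n = n} {m} am fun) (here refl) rewrite update-at ρ n m = here refl
map-u (atomMap-extend {ρ = ρ} {Γ = Γ} {n = n} {m} am fun) {a} {ψ} (there p) with a ≡ᵇ n in eq
... | true  = here (cong (u m ,_) (fun (there (subst (λ x → (u x , ψ) ∈ atoms Γ) (≡ᵇ-true⇒≡ eq) p)) (here refl)))
... | false = there (map-u am p)

UnksIncl : ∀ {B : Set} → Ctx B → Ctx B → Set
UnksIncl Γ Γ' = ∀ {Y ψ} → (Y , ψ) ∈ unks Γ → (Y , ψ) ∈ unks Γ'

module Typed {B C : Set} (ctype : C → Ty B) where
  _⊩_∶_ : Ctx B → Term B C → Ty B → Set
  Γ ⊩ r ∶ φ = _⊢_∶_ ctype Γ r φ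

  Typedᴹ : Ctx B → Moderation B C → Set
  Typedᴹ Γ ms = ModTyped ctype Γ ms

  mutual
    typed-lc : ∀ {Γ r φ} → Γ ⊩ r ∶ φ → lc 0 r
    typed-lc (⊢atom _)                  = tt
    typed-lc ⊢con                       = tt
    typed-lc (⊢lam {r = r} n _ _ body)  = lc-opened 0 (u n) r (typed-lc body)
    typed-lc (⊢app p q)                 = typed-lc p , typed-lc q
    typed-lc (⊢meta _ mt)               = typedᴹ-lc mt

    typedᴹ-lc : ∀ {Γ ms} → Typedᴹ Γ ms → lcMod 0 ms
    typedᴹ-lc []                  = tt
    typedᴹ-lc ((_ , _ , p) ∷ mt)  = typed-lc p , typedᴹ-lc mt

  -- To type λφ.s it suffices to type its body opened at every name m
  -- that the extended environment allows: the rule is applied to one such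
  -- m chosen fresh for s and for Γ.
  lam-intro : ∀ {Γ φ ψ} (s : Term B C) → IsEnv Γ →
              (∀ m → IsEnv (Γ ,ᵃ u m ∶ φ) → (Γ ,ᵃ u m ∶ φ) ⊩ instantiate s (u m) ∶ ψ) →
              Γ ⊩ lam φ s ∶ (φ ⇒ ψ)
  lam-intro {Γ} s env body = ⊢lam m m∉s env' (body m env')
    where
      avoid = faᵤ s ++ unames (atoms Γ)
      m     = fresh avoid
      m∉s : m ∉ faᵤ s
      m∉s p = fresh∉ avoid (∈-++⁺ˡ p)
      env' : IsEnv (Γ ,ᵃ u _ ∶ _)
      env' = extend-env env (λ p → fresh∉ avoid (∈-++⁺ʳ (faᵤ s) p))

  mutual
    rename-typed : ∀ {Γ Γ' r φ} ρ → AtomMap ρ Γ Γ' → UnksIncl Γ Γ' → IsEnv Γ' →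
                   Γ ⊩ r ∶ φ → Γ' ⊩ rn ρ r ∶ φ
    rename-typed ρ am ui env (⊢atom {a = d b} p) = ⊢atom (map-d am p)
    rename-typed ρ am ui env (⊢atom {a = u a} p) = ⊢atom (map-u am p)
    rename-typed ρ am ui env ⊢con                = ⊢con
    rename-typed ρ am ui env (⊢lam {φ} {ψ} {r} n n∉ envn body) =
      lam-intro (rn ρ r) env λ m envm →
        subst (λ s → _ ⊩ s ∶ ψ) (rename-open ρ m r n∉)
          (rename-typed (ρ [ n ↦ m ]) (atomMap-extend am (proj₁ envn)) ui envm body)
    rename-typed ρ am ui env (⊢app p q) = ⊢app (rename-typed ρ am ui env p) (rename-typed ρ am ui env q)
    rename-typed ρ am ui env (⊢meta x mt) = ⊢meta (ui x) (renameᴹ-typed ρ am ui env mt)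

    renameᴹ-typed : ∀ {Γ Γ' ms} ρ → AtomMap ρ Γ Γ' → UnksIncl Γ Γ' → IsEnv Γ' →
                    Typedᴹ Γ ms → Typedᴹ Γ' (rnMod ρ ms)
    renameᴹ-typed ρ am ui env []                 = []
    renameᴹ-typed ρ am ui env ((ψ , p , q) ∷ mt) =
      (ψ , map-d am p , rename-typed ρ am ui env q) ∷ renameᴹ-typed ρ am ui env mt

  weaken : ∀ {Γ t ξ m φ} → IsEnv (Γ ,ᵃ u m ∶ φ) → Γ ⊩ t ∶ ξ → (Γ ,ᵃ u m ∶ φ) ⊩ t ∶ ξ
  weaken {t = t} {ξ} env p =
    subst (λ s → _ ⊩ s ∶ ξ) (rn-id t) (rename-typed (λ x → x) atomMap-weaken (λ q → q) env p)

  weakenᴹ : ∀ {Γ σ m φ} → IsEnv (Γ ,ᵃ u m ∶ φ) → Typedᴹ Γ σ → Typedᴹ (Γ ,ᵃ u m ∶ φ) σ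
  weakenᴹ env []                 = []
  weakenᴹ env ((ψ , p , q) ∷ mt) = (ψ , there p , weaken env q) ∷ weakenᴹ env mt

  typedᴹ-++ : ∀ {Γ σ τ} → Typedᴹ Γ σ → Typedᴹ Γ τ → Typedᴹ Γ (σ ++ τ)
  typedᴹ-++ []       q = q
  typedᴹ-++ (x ∷ p)  q = x ∷ typedᴹ-++ p q

  typedᴹ-dropKeys : ∀ {Γ} ks {σ} → Typedᴹ Γ σ → Typedᴹ Γ (dropKeys ks σ)
  typedᴹ-dropKeys ks [] = []
  typedᴹ-dropKeys ks {(b , s) ∷ σ} (x ∷ p) with memᵇ {B} {C} b ks
  ... | true  = typedᴹ-dropKeys ks p
  ... | false = x ∷ typedᴹ-dropKeys ks p

  -- Substituting a typed moderation for a typed 𝔸_d-atom preserves its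
  -- type; functionality of Γ identifies the two types of the atom.
  atomSub-typed : ∀ {Γ b φ σ} → Functional (atoms Γ) → (d b , φ) ∈ atoms Γ → Typedᴹ Γ σ →
                  Γ ⊩ atomSub b (lookupMod b σ) ∶ φ
  atomSub-typed fun p [] = ⊢atom p
  atomSub-typed {Γ} {b} {φ} {(b' , s) ∷ σ} fun p ((ψ , q , der) ∷ mt) with b ≡ᵇ b' in eq
  ... | true  = subst (Γ ⊩ s ∶_) (fun (subst (λ x → (d x , ψ) ∈ atoms Γ) (sym (≡ᵇ-true⇒≡ eq)) q) p) der
  ... | false = atomSub-typed fun p mt

  mutual
    subst₁-rename-typed : ∀ {Γ Γ' t ξ σ} ρ → AtomMap ρ Γ Γ' → UnksIncl Γ Γ' → IsEnv Γ' →
                          Typedᴹ Γ' σ → Γ ⊩ t ∶ ξ → Γ' ⊩ (rn ρ t) [ σ ]₁ ∶ ξ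
    subst₁-rename-typed {σ = σ} ρ am ui env mt (⊢atom {a = d b} {φ} p) =
      subst (_ ⊩_∶ φ) (sym (atom-subst b σ)) (atomSub-typed (proj₁ env) (map-d am p) mt)
    subst₁-rename-typed ρ am ui env mt (⊢atom {a = u a} p) = ⊢atom (map-u am p)
    subst₁-rename-typed ρ am ui env mt ⊢con = ⊢con
    subst₁-rename-typed {σ = σ} ρ am ui env mt (⊢lam {φ} {ψ} {r} n n∉ envn body) =
      subst (λ σ' → _ ⊩ lam φ ((rn ρ r) [ σ' ]₁) ∶ (φ ⇒ ψ)) (sym (shiftMod-lc 0 σ lcσ))
        (lam-intro ((rn ρ r) [ σ ]₁) env λ m envm →
          subst (λ s → _ ⊩ s ∶ ψ)
            (trans (cong (_[ σ ]₁) (rename-open ρ m r n∉)) (sym (open-subst₁-closed m (rn ρ r) σ lcσ)))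
            (subst₁-rename-typed (ρ [ n ↦ m ]) (atomMap-extend am (proj₁ envn)) ui envm (weakenᴹ envm mt) body))
      where lcσ = typedᴹ-lc mt
    subst₁-rename-typed ρ am ui env mt (⊢app p q) =
      ⊢app (subst₁-rename-typed ρ am ui env mt p) (subst₁-rename-typed ρ am ui env mt q)
    subst₁-rename-typed ρ am ui env mt (⊢meta {ms = ms} x mt') =
      ⊢meta (ui x) (typedᴹ-++ (subst₁ᴹ-rename-typed ρ am ui env mt mt')
                              (typedᴹ-dropKeys (keys (rnMod ρ ms)) mt))

    subst₁ᴹ-rename-typed : ∀ {Γ Γ' ms σ} ρ → AtomMap ρ Γ Γ' → UnksIncl Γ Γ' → IsEnv Γ' →
                           Typedᴹ Γ' σ → Typedᴹ Γ ms → Typedᴹ Γ' (substMod (rnMod ρ ms) σ)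
    subst₁ᴹ-rename-typed ρ am ui env mt []                  = []
    subst₁ᴹ-rename-typed ρ am ui env mt ((ψ , p , q) ∷ mt') =
      (ψ , map-d am p , subst₁-rename-typed ρ am ui env mt q) ∷ subst₁ᴹ-rename-typed ρ am ui env mt mt'

  subst₁-typed : ∀ {Γ t ξ σ} → IsEnv Γ → Typedᴹ Γ σ → Γ ⊩ t ∶ ξ → Γ ⊩ t [ σ ]₁ ∶ ξ
  subst₁-typed {t = t} {ξ} {σ} env mt p =
    subst (λ s → _ ⊩ s [ σ ]₁ ∶ ξ) (rn-id t) (subst₁-rename-typed (λ x → x) atomMap-id (λ q → q) env mt p)

  module _ (X : Unknown) (ξ : Ty B) (t : Term B C) where
    mutual
      subst₂-rename-typed : ∀ {Δ Γ' r φ} ρ → AtomMap ρ Δ Γ' →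
        (∀ {ψ} → (X , ψ) ∈ unks Δ → ψ ≡ ξ) →
        (∀ {Y ψ} → (Y , ψ) ∈ unks Δ → Y ≢ X → (Y , ψ) ∈ unks Γ') →
        IsEnv Γ' → Γ' ⊩ t ∶ ξ → Δ ⊩ r ∶ φ → Γ' ⊩ (rn ρ r) [ X ≔ t ]₂ ∶ φ
      subst₂-rename-typed ρ am uX uY env ⊢t (⊢atom {a = d b} p) = ⊢atom (map-d am p)
      subst₂-rename-typed ρ am uX uY env ⊢t (⊢atom {a = u a} p) = ⊢atom (map-u am p)
      subst₂-rename-typed ρ am uX uY env ⊢t ⊢con = ⊢con
      subst₂-rename-typed ρ am uX uY env ⊢t (⊢lam {φ} {ψ} {r} n n∉ envn body) =
        lam-intro ((rn ρ r) [ X ≔ t ]₂) env λ m envm →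
          subst (λ s → _ ⊩ s ∶ ψ)
            (trans (cong (_[ X ≔ t ]₂) (rename-open ρ m r n∉)) (sym (open-subst₂ X t (typed-lc ⊢t) 0 m (rn ρ r))))
            (subst₂-rename-typed (ρ [ n ↦ m ]) (atomMap-extend am (proj₁ envn)) uX uY envm (weaken envm ⊢t) body)
      subst₂-rename-typed ρ am uX uY env ⊢t (⊢app p q) =
        ⊢app (subst₂-rename-typed ρ am uX uY env ⊢t p) (subst₂-rename-typed ρ am uX uY env ⊢t q)
      subst₂-rename-typed {Δ} ρ am uX uY env ⊢t (⊢meta {X = Y} {φ} x mt) with Y ≡ᵇ X in eq
      ... | true  = subst (_ ⊩ _ ∶_) (sym (uX (subst (λ Z → (Z , φ) ∈ unks Δ) (≡ᵇ-true⇒≡ eq) x)))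
                      (subst₁-typed env (subst₂ᴹ-rename-typed ρ am uX uY env ⊢t mt) ⊢t)
      ... | false = ⊢meta (uY x (≡ᵇ-false⇒≢ eq)) (subst₂ᴹ-rename-typed ρ am uX uY env ⊢t mt)

      subst₂ᴹ-rename-typed : ∀ {Δ Γ' ms} ρ → AtomMap ρ Δ Γ' →
        (∀ {ψ} → (X , ψ) ∈ unks Δ → ψ ≡ ξ) →
        (∀ {Y ψ} → (Y , ψ) ∈ unks Δ → Y ≢ X → (Y , ψ) ∈ unks Γ') →
        IsEnv Γ' → Γ' ⊩ t ∶ ξ → Typedᴹ Δ ms → Typedᴹ Γ' (subst₂Mod (rnMod ρ ms) X t)
      subst₂ᴹ-rename-typed ρ am uX uY env ⊢t []                 = []
      subst₂ᴹ-rename-typed ρ am uX uY env ⊢t ((ψ , p , q) ∷ mt) =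
        (ψ , map-d am p , subst₂-rename-typed ρ am uX uY env ⊢t q) ∷ subst₂ᴹ-rename-typed ρ am uX uY env ⊢t mt

proposition5p2 : {B C : Set} (ctype : C → Ty B) (Γ : Ctx B) (X : Unknown)
    (ξ φ : Ty B) (r t : Term B C) →
    WF r → WF t → IsEnv (Γ ,ˣ X ∶ ξ) →
    _⊢_∶_ ctype (Γ ,ˣ X ∶ ξ) r φ → _⊢_∶_ ctype Γ t ξ →
    _⊢_∶_ ctype Γ (r [ X ≔ t ]₂) φ
proposition5p2 ctype Γ X ξ φ r t _ _ (funA , funU) ⊢r ⊢t =
  subst (λ s → _⊢_∶_ ctype Γ (s [ X ≔ t ]₂) φ) (rn-id r)
    (Typed.subst₂-rename-typed ctype X ξ t (λ x → x) sameAtoms typeOfX othersInΓ envΓ ⊢t ⊢r)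
  where
    envΓ : IsEnv Γ
    envΓ = funA , (λ p q → funU (there p) (there q))
    sameAtoms : AtomMap (λ x → x) (Γ ,ˣ X ∶ ξ) Γ
    map-d sameAtoms p = p
    map-u sameAtoms p = p
    typeOfX : ∀ {ψ} → (X , ψ) ∈ unks (Γ ,ˣ X ∶ ξ) → ψ ≡ ξ
    typeOfX p = funU p (here refl)
    othersInΓ : ∀ {Y ψ} → (Y , ψ) ∈ unks (Γ ,ˣ X ∶ ξ) → Y ≢ X → (Y , ψ) ∈ unks Γ
    othersInΓ (here refl) Y≢X = ⊥-elim (Y≢X refl)
    othersInΓ (there p)   _   = p
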